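{- If $G$ is a graph of order $n$ with no isolated vertex and maximum degree $\Delta$, then \[ \frac{n}{\Delta+1} \le \Psi_g^-(G) \le \frac{\Delta n}{\Delta+1} \quad\text{and}\quad \frac{n}{\Delta+1} \le \Psi_g^+(G) \le \frac{\Delta n}{\Delta+1}. \]
   Context: For a set $S$ of vertices of a graph $G$, a vertex $v \in S$ is an enclave of $S$ if $N[v] \subseteq S$; $S$ is enclaveless if it contains no enclave. The competition-enclaveless game on $G$ is played by Maximizer and Minimizer, who alternately choose a vertex $v$ not in the set $S$ of previously chosen vertices such that $S\cup\{v\}$ is enclaveless; the game ends when no such vertex exists. Maximizer aims to maximize and Minimizer to minimize the final $|S|$. $\Psi_g^+(G)$ is the final $|S|$ when Maximizer moves first and both play optimally; $\Psi_g^-(G)$ is the same when Minimizer moves first. -}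

module Defs where

open import Data.Nat using (ℕ; zero; suc; _⊔_; _⊓_; _≤_)
open import Data.Fin using (Fin; _≟_)
open import Data.Fin.Subset using (Subset; _∈_; _∉_; _∪_; ⁅_⁆; ∣_∣)
open import Data.Fin.Subset.Properties using (_∈?_)
open import Data.Fin.Properties using (all?; any?)
open import Data.List using (List; []; _∷_; filter; foldr)
import Data.List.Base
import Data.Fin.Subset
open import Data.Vec using (tabulate)
open import Data.Product using (Σ; _×_; _,_; ∃)
open import Data.Sum using (_⊎_)
open import Relation.Nullary using (¬_; Dec; yes; no)
open import Relation.Nullary.Decidable using (isYes; _×-dec_; _⊎-dec_; ¬?; _→-dec_)
open import Relation.Binary.PropositionalEquality using (_≡_)

record Graph (n : ℕ) : Set₁ where
  field
    Adj     : Fin n → Fin n → Set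
    adj?    : (u v : Fin n) → Dec (Adj u v)
    sym     : ∀ {u v} → Adj u v → Adj v u
    irrefl  : ∀ {u} → ¬ Adj u u

module _ {n : ℕ} (G : Graph n) where
  open Graph G

  nbhd : Fin n → Subset n
  nbhd v = tabulate (λ u → isYes (adj? v u))

  degree : Fin n → ℕ
  degree v = ∣ nbhd v ∣

  InClosedNbhd : Fin n → Fin n → Set
  InClosedNbhd v u = (u ≡ v) ⊎ Adj v u

  NoIsolatedVertex : Set
  NoIsolatedVertex = ∀ v → ∃ λ u → Adj v u

  IsMaxDegree : ℕ → Set
  IsMaxDegree Δ = (∀ v → degree v ≤ Δ) × (∃ λ v → degree v ≡ Δ)

  IsEnclave : Subset n → Fin n → Set
  IsEnclave S v = v ∈ S × (∀ u → InClosedNbhd v u → u ∈ S)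

  Enclaveless : Subset n → Set
  Enclaveless S = ∀ v → ¬ IsEnclave S v

  isEnclave? : (S : Subset n) (v : Fin n) → Dec (IsEnclave S v)
  isEnclave? S v = (v ∈? S) ×-dec all? (λ u → ((u ≟ v) ⊎-dec adj? v u) →-dec (u ∈? S))

  enclaveless? : (S : Subset n) → Dec (Enclaveless S)
  enclaveless? S = all? (λ v → ¬? (isEnclave? S v))

  LegalMove : Subset n → Fin n → Set
  LegalMove S v = v ∉ S × Enclaveless (⁅ v ⁆ ∪ S)

  legal? : (S : Subset n) (v : Fin n) → Dec (LegalMove S v)
  legal? S v = ¬? (v ∈? S) ×-dec enclaveless? (⁅ v ⁆ ∪ S)

  allVertices : List (Fin n)
  allVertices = Data.List.Base.allFin n

  legalMoves : Subset n → List (Fin n)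
  legalMoves S = filter (legal? S) allVertices

data Player : Set where
  Maximizer Minimizer : Player

other : Player → Player
other Maximizer = Minimizer
other Minimizer = Maximizer

combine : Player → ℕ → ℕ → ℕ
combine Maximizer = _⊔_
combine Minimizer = _⊓_

module _ {n : ℕ} (G : Graph n) where

  -- Optimal-play value of the competition-enclaveless game from position S
  -- with player p to move, looking ahead at most k moves.  Every move adds a
  -- new vertex, so from any position at most n further moves are possible and
  -- gameValue n p S is the exact minimax value.
  gameValue : ℕ → Player → Subset n → ℕ
  gameValue zero    p S = ∣ S ∣
  gameValue (suc k) p S with legalMoves G S
  ... | []     = ∣ S ∣
  ... | v ∷ vs = foldr (λ w acc → combine p acc (val w)) (val v) vs
    where
      val : Fin n → ℕ
      val w = gameValue k (other p) (⁅ w ⁆ ∪ S)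

  emptySet : Subset n
  emptySet = Data.Fin.Subset.⊥

  Ψ⁺ : ℕ
  Ψ⁺ = gameValue n Maximizer emptySet

  Ψ⁻ : ℕ
  Ψ⁻ = gameValue n Minimizer emptySet

-- Every position of the game is enclaveless, so each chosen vertex has a neighbour outside the
-- chosen set S, and counting these neighbours gives |S| ≤ Δ (n − |S|).  When the game ends no
-- further vertex can be added, which (as G has no isolated vertex) forces every unchosen vertex
-- to have a neighbour in S, so n − |S| ≤ Δ |S|.  Under optimal play the outcome is the size of
-- some final position, whoever starts, so both bounds hold for Ψ⁺ and Ψ⁻.
module Submission where

open import Defs
open import Algebra.Definitions using (Selective)
open import Data.Empty using (⊥-elim)
open import Data.Fin using (Fin; _≟_)
import Data.Fin as Fin
open import Data.Fin.Properties using (¬∀⟶∃¬)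
open import Data.Fin.Subset
  using (Subset; inside; outside; _∈_; _∉_; _∪_; ⁅_⁆; ∣_∣; ∁; ⋃; _⊆_)
open import Data.Fin.Subset.Properties
open import Data.List using (List; []; _∷_; foldr; map; length)
open import Data.List.Properties using (length-map)
open import Data.List.Membership.Propositional using () renaming (_∈_ to _∈ₗ_)
open import Data.List.Membership.Propositional.Properties
  using (∈-filter⁺; ∈-filter⁻; ∈-allFin; ∈-map⁺)
open import Data.List.Relation.Unary.All as All using (All)
open import Data.List.Relation.Unary.All.Properties using () renaming (map⁺ to All-map⁺)
open import Data.List.Relation.Unary.Any using (here; there)
open import Data.Nat using (ℕ; zero; suc; z≤n; s≤s; _≤_; _*_; _+_)
open import Data.Nat.Properties hiding (_≟_)
open import Data.Product using (_×_; _,_; ∃; proj₁; proj₂)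
open import Data.Sum using (inj₁; inj₂)
open import Data.Vec using ([]; _∷_)
import Data.Vec as Vec
open import Data.Vec.Properties using (lookup∘tabulate; lookup⇒[]=)
open import Relation.Nullary using (¬_; Dec; yes; no; ¬?)
open import Relation.Nullary.Decidable using (isYes; isYes≗does; dec-true; decidable-stable; _→-dec_; _⊎-dec_)
open import Relation.Binary.PropositionalEquality using (_≡_; _≢_; refl; sym; trans; cong; subst)

module _ {a b} {A : Set a} {B : Set b} where

  dec-¬→ : Dec A → ¬ (A → B) → A × ¬ B
  dec-¬→ (yes x) f = x , λ y → f (λ _ → y)
  dec-¬→ (no ¬x) f = ⊥-elim (f (λ x → ⊥-elim (¬x x)))

  foldr-selective : {_∙_ : B → B → B} → Selective _≡_ _∙_ →
                    (f : A → B) (x : A) (xs : List A) →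
                    ∃ λ y → y ∈ₗ x ∷ xs × foldr (λ y acc → acc ∙ f y) (f x) xs ≡ f y
  foldr-selective sel f x [] = x , here refl , refl
  foldr-selective {_∙_} sel f x (z ∷ zs)
    with foldr-selective sel f x zs | sel (foldr (λ y acc → acc ∙ f y) (f x) zs) (f z)
  ... | y , y∈ , eq | inj₁ e = y , there′ y∈ , trans e eq
    where
    there′ : y ∈ₗ x ∷ zs → y ∈ₗ x ∷ z ∷ zs
    there′ (here p) = here p
    there′ (there m) = there (there m)
  ... | _ , _ , _ | inj₂ e = z , there (here refl) , e

combine-selective : ∀ p → Selective _≡_ (combine p)
combine-selective Maximizer = ⊔-sel
combine-selective Minimizer = ⊓-sel

∣p∪q∣≤∣p∣+∣q∣ : ∀ {n} (p q : Subset n) → ∣ p ∪ q ∣ ≤ ∣ p ∣ + ∣ q ∣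
∣p∪q∣≤∣p∣+∣q∣ []            []            = z≤n
∣p∪q∣≤∣p∣+∣q∣ (outside ∷ p) (outside ∷ q) = ∣p∪q∣≤∣p∣+∣q∣ p q
∣p∪q∣≤∣p∣+∣q∣ (outside ∷ p) (inside  ∷ q) =
  ≤-trans (s≤s (∣p∪q∣≤∣p∣+∣q∣ p q)) (≤-reflexive (sym (+-suc ∣ p ∣ ∣ q ∣)))
∣p∪q∣≤∣p∣+∣q∣ (inside  ∷ p) (outside ∷ q) = s≤s (∣p∪q∣≤∣p∣+∣q∣ p q)
∣p∪q∣≤∣p∣+∣q∣ (inside  ∷ p) (inside  ∷ q) =
  s≤s (≤-trans (∣p∪q∣≤∣p∣+∣q∣ p q) (+-monoʳ-≤ ∣ p ∣ (n≤1+n ∣ q ∣)))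

∣⋃ps∣≤d*length : ∀ {n d} (ps : List (Subset n)) → All (λ p → ∣ p ∣ ≤ d) ps →
                 ∣ ⋃ ps ∣ ≤ d * length ps
∣⋃ps∣≤d*length {n} {d} []       All.[] = ≤-reflexive (trans (∣⊥∣≡0 n) (sym (*-zeroʳ d)))
∣⋃ps∣≤d*length {d = d} (p ∷ ps) (∣p∣≤d All.∷ bounds) = begin
  ∣ p ∪ ⋃ ps ∣            ≤⟨ ∣p∪q∣≤∣p∣+∣q∣ p (⋃ ps) ⟩
  ∣ p ∣ + ∣ ⋃ ps ∣        ≤⟨ +-mono-≤ ∣p∣≤d (∣⋃ps∣≤d*length ps bounds) ⟩
  d + d * length ps       ≡⟨ sym (*-suc d (length ps)) ⟩
  d * suc (length ps)     ∎
  where open ≤-Reasoning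

x∈⋃⁺ : ∀ {n} {x : Fin n} {p ps} → x ∈ p → p ∈ₗ ps → x ∈ ⋃ ps
x∈⋃⁺ x∈p (here refl) = x∈p∪q⁺ (inj₁ x∈p)
x∈⋃⁺ x∈p (there p∈) = x∈p∪q⁺ (inj₂ (x∈⋃⁺ x∈p p∈))

elements : ∀ {n} → Subset n → List (Fin n)
elements []            = []
elements (inside  ∷ p) = Fin.zero ∷ map Fin.suc (elements p)
elements (outside ∷ p) = map Fin.suc (elements p)

length-elements : ∀ {n} (p : Subset n) → length (elements p) ≡ ∣ p ∣
length-elements []            = refl
length-elements (inside  ∷ p) = cong suc (trans (length-map Fin.suc (elements p)) (length-elements p))
length-elements (outside ∷ p) = trans (length-map Fin.suc (elements p)) (length-elements p)

∈-elements : ∀ {n} {x : Fin n} {p} → x ∈ p → x ∈ₗ elements p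
∈-elements {p = inside  ∷ p} Vec.here       = here refl
∈-elements {p = inside  ∷ p} (Vec.there x∈) = there (∈-map⁺ Fin.suc (∈-elements x∈))
∈-elements {p = outside ∷ p} (Vec.there x∈) = ∈-map⁺ Fin.suc (∈-elements x∈)

∣p∣+∣∁p∣≡n : ∀ {n} (p : Subset n) → ∣ p ∣ + ∣ ∁ p ∣ ≡ n
∣p∣+∣∁p∣≡n p = trans (cong (∣ p ∣ +_) (∣∁p∣≡n∸∣p∣ p)) (m+[n∸m]≡n (∣p∣≤n p))

n≤∣p∣⇒x∈p : ∀ {n} {x : Fin n} {p : Subset n} → n ≤ ∣ p ∣ → x ∈ p
n≤∣p∣⇒x∈p {p = p} n≤∣p∣ = subst (_ ∈_) (sym (∣p∣≡n⇒p≡⊤ (≤-antisym (∣p∣≤n p) n≤∣p∣))) ∈⊤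

x∈⁅y⁆∪p⇒x∈p : ∀ {n} {x y : Fin n} {p} → x ∈ ⁅ y ⁆ ∪ p → x ≢ y → x ∈ p
x∈⁅y⁆∪p⇒x∈p {y = y} {p} x∈ x≢y with x∈p∪q⁻ ⁅ y ⁆ p x∈
... | inj₁ x∈⁅y⁆ = ⊥-elim (x≢y (x∈⁅y⁆⇒x≡y y x∈⁅y⁆))
... | inj₂ x∈p   = x∈p

[Δ+1]*s≤Δ*n : ∀ {Δ s c n} → s + c ≡ n → s ≤ Δ * c → (Δ + 1) * s ≤ Δ * n
[Δ+1]*s≤Δ*n {Δ} {s} {c} {n} s+c≡n s≤Δc = begin
  (Δ + 1) * s    ≡⟨ cong (_* s) (+-comm Δ 1) ⟩
  s + Δ * s      ≡⟨ +-comm s (Δ * s) ⟩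
  Δ * s + s      ≤⟨ +-monoʳ-≤ (Δ * s) s≤Δc ⟩
  Δ * s + Δ * c  ≡⟨ sym (*-distribˡ-+ Δ s c) ⟩
  Δ * (s + c)    ≡⟨ cong (Δ *_) s+c≡n ⟩
  Δ * n          ∎
  where open ≤-Reasoning

n≤[Δ+1]*s : ∀ {Δ s c n} → s + c ≡ n → c ≤ Δ * s → n ≤ (Δ + 1) * s
n≤[Δ+1]*s {Δ} {s} {c} {n} s+c≡n c≤Δs = begin
  n              ≡⟨ sym s+c≡n ⟩
  s + c          ≤⟨ +-monoʳ-≤ s c≤Δs ⟩
  s + Δ * s      ≡⟨ cong (_* s) (+-comm 1 Δ) ⟩
  (Δ + 1) * s    ∎
  where open ≤-Reasoning

module _ {n : ℕ} (G : Graph n) where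
  open Graph G renaming (sym to Adj-sym)

  Adj⇒∈nbhd : ∀ {v u} → Adj v u → u ∈ nbhd G v
  Adj⇒∈nbhd {v} {u} v~u = lookup⇒[]= u (nbhd G v)
    (trans (lookup∘tabulate (λ w → isYes (adj? v w)) u)
           (trans (isYes≗does (adj? v u)) (dec-true (adj? v u) v~u)))

  ∣p∣≤Δ*∣q∣ : ∀ {Δ} → (∀ v → degree G v ≤ Δ) → {p q : Subset n} →
              (∀ {v} → v ∈ p → ∃ λ u → u ∈ q × Adj v u) → ∣ p ∣ ≤ Δ * ∣ q ∣
  ∣p∣≤Δ*∣q∣ {Δ} degree≤Δ {p} {q} dominated = begin
    ∣ p ∣             ≤⟨ p⊆q⇒∣p∣≤∣q∣ p⊆⋃nbhds ⟩
    ∣ ⋃ nbhds ∣       ≤⟨ ∣⋃ps∣≤d*length nbhds (All-map⁺ (All.universal degree≤Δ (elements q))) ⟩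
    Δ * length nbhds  ≡⟨ cong (Δ *_) (trans (length-map (nbhd G) (elements q)) (length-elements q)) ⟩
    Δ * ∣ q ∣         ∎
    where
    open ≤-Reasoning
    nbhds : List (Subset n)
    nbhds = map (nbhd G) (elements q)
    p⊆⋃nbhds : p ⊆ ⋃ nbhds
    p⊆⋃nbhds v∈p with dominated v∈p
    ... | u , u∈q , v~u = x∈⋃⁺ (Adj⇒∈nbhd (Adj-sym v~u)) (∈-map⁺ (nbhd G) (∈-elements u∈q))

  enclaveless⇒Adj∉ : ∀ {S} → Enclaveless G S → ∀ {v} → v ∈ S → ∃ λ u → u ∉ S × Adj v u
  enclaveless⇒Adj∉ {S} enclaveless {v} v∈S with
    ¬∀⟶∃¬ n (λ u → Adj v u → u ∈ S) (λ u → adj? v u →-dec (u ∈? S))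
      (λ N⊆S → enclaveless v (v∈S , λ { u (inj₁ refl) → v∈S ; u (inj₂ v~u) → N⊆S u v~u }))
  ... | u , N⊈S with dec-¬→ (adj? v u) N⊈S
  ...   | v~u , u∉S = u , u∉S , v~u

  Terminal : Subset n → Set
  Terminal S = ∀ v → ¬ LegalMove G S v

  enclave-of-insertion : ∀ {S v w} → IsEnclave G (⁅ v ⁆ ∪ S) w → ¬ IsEnclave G S w →
                         InClosedNbhd G w v
  enclave-of-insertion {S} {v} {w} (_ , N[w]⊆) not-enclave
    with (v ≟ w) ⊎-dec adj? w v
  ... | yes v∈N[w] = v∈N[w]
  ... | no v∉N[w] = ⊥-elim (not-enclave (in-S w (inj₁ refl) , in-S))
    where
    in-S : ∀ u → InClosedNbhd G w u → u ∈ S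
    in-S u u∈N[w] = x∈⁅y⁆∪p⇒x∈p (N[w]⊆ u u∈N[w]) λ { refl → v∉N[w] u∈N[w] }

  -- Adding v creates an enclave w with v ∈ N[w]: if w = v, a neighbour of v lies in S; otherwise w does.
  terminal⇒Adj∈ : NoIsolatedVertex G → ∀ {S} → Enclaveless G S → Terminal S →
                  ∀ {v} → v ∉ S → ∃ λ u → u ∈ S × Adj v u
  terminal⇒Adj∈ no-isolated {S} enclaveless terminal {v} v∉S
    with ¬∀⟶∃¬ n (λ w → ¬ IsEnclave G (⁅ v ⁆ ∪ S) w) (λ w → ¬? (isEnclave? G (⁅ v ⁆ ∪ S) w))
                  (λ enclaveless′ → terminal v (v∉S , enclaveless′))
  ... | w , ¬¬enclave with decidable-stable (isEnclave? G (⁅ v ⁆ ∪ S) w) ¬¬enclave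
  ...   | enclave with enclave-of-insertion enclave (enclaveless w)
  ...     | inj₁ refl with no-isolated v
  ...       | u , v~u = u , x∈⁅y⁆∪p⇒x∈p (proj₂ enclave u (inj₂ v~u)) (λ { refl → irrefl v~u }) , v~u
  terminal⇒Adj∈ no-isolated {S} enclaveless terminal {v} v∉S
    | w , _ | enclave | inj₂ w~v =
    w , x∈⁅y⁆∪p⇒x∈p (proj₁ enclave) (λ { refl → irrefl w~v }) , Adj-sym w~v

  legalMoves≡[]⇒terminal : ∀ {S} → legalMoves G S ≡ [] → Terminal S
  legalMoves≡[]⇒terminal {S} no-moves v legal
    with subst (v ∈ₗ_) no-moves (∈-filter⁺ (legal? G S) (∈-allFin v) legal)
  ... | ()

  full⇒terminal : ∀ {S} → n ≤ ∣ S ∣ → Terminal S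
  full⇒terminal n≤∣S∣ v (v∉S , _) = v∉S (n≤∣p∣⇒x∈p n≤∣S∣)

  -- Each move enlarges S, so n ≤ k + ∣ S ∣ ensures the look-ahead k never runs out before the game ends.
  gameValue-attained : ∀ k p S → Enclaveless G S → n ≤ k + ∣ S ∣ →
                       ∃ λ T → Enclaveless G T × Terminal T × gameValue G k p S ≡ ∣ T ∣
  gameValue-attained zero p S enclaveless n≤∣S∣ = S , enclaveless , full⇒terminal n≤∣S∣ , refl
  gameValue-attained (suc k) p S enclaveless n≤k+1+∣S∣ with legalMoves G S in moves
  ... | [] = S , enclaveless , legalMoves≡[]⇒terminal moves , refl
  ... | v ∷ vs
    with foldr-selective (combine-selective p) (λ w → gameValue G k (other p) (⁅ w ⁆ ∪ S)) v vs
  ... | w , w∈moves , value≡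
    with ∈-filter⁻ (legal? G S) {xs = allVertices G} (subst (w ∈ₗ_) (sym moves) w∈moves)
  ... | _ , w∉S , enclaveless′
    with gameValue-attained k (other p) (⁅ w ⁆ ∪ S) enclaveless′ n≤k+∣S′∣
    where
    n≤k+∣S′∣ : n ≤ k + ∣ ⁅ w ⁆ ∪ S ∣
    n≤k+∣S′∣ = ≤-trans n≤k+1+∣S∣ (≤-trans (≤-reflexive (sym (+-suc k ∣ S ∣)))
      (+-monoʳ-≤ k (p⊂q⇒∣p∣<∣q∣ (q⊆p∪q ⁅ w ⁆ S , w , x∈p∪q⁺ (inj₁ (x∈⁅x⁆ w)) , w∉S))))
  ... | T , T-enclaveless , T-terminal , value≡∣T∣ =
    T , T-enclaveless , T-terminal , trans value≡ value≡∣T∣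

  module _ {Δ} (degree≤Δ : ∀ v → degree G v ≤ Δ) where

    enclaveless⇒upper-bound : ∀ {S} → Enclaveless G S → (Δ + 1) * ∣ S ∣ ≤ Δ * n
    enclaveless⇒upper-bound {S} enclaveless = [Δ+1]*s≤Δ*n {Δ} (∣p∣+∣∁p∣≡n S)
      (∣p∣≤Δ*∣q∣ degree≤Δ λ v∈S → let u , u∉S , v~u = enclaveless⇒Adj∉ enclaveless v∈S
                                   in u , x∉p⇒x∈∁p u∉S , v~u)

    terminal⇒lower-bound : NoIsolatedVertex G → ∀ {S} → Enclaveless G S → Terminal S →
                           n ≤ (Δ + 1) * ∣ S ∣
    terminal⇒lower-bound no-isolated {S} enclaveless terminal = n≤[Δ+1]*s {Δ} (∣p∣+∣∁p∣≡n S)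
      (∣p∣≤Δ*∣q∣ degree≤Δ λ v∈∁S → terminal⇒Adj∈ no-isolated enclaveless terminal (x∈∁p⇒x∉p v∈∁S))

    gameValue-bounds : NoIsolatedVertex G → ∀ p → let ψ = gameValue G n p (emptySet G) in
                       n ≤ (Δ + 1) * ψ × (Δ + 1) * ψ ≤ Δ * n
    gameValue-bounds no-isolated p
      with gameValue-attained n p (emptySet G) (λ _ (v∈∅ , _) → ∉⊥ v∈∅) (m≤m+n n _)
    ... | T , enclaveless , terminal , value≡∣T∣ rewrite value≡∣T∣ =
      terminal⇒lower-bound no-isolated enclaveless terminal , enclaveless⇒upper-bound enclaveless

proposition3p2 : (n : ℕ) (G : Graph n) (Δ : ℕ) →
    NoIsolatedVertex G → IsMaxDegree G Δ →
    (n ≤ (Δ + 1) * Ψ⁻ G × (Δ + 1) * Ψ⁻ G ≤ Δ * n) ×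
    (n ≤ (Δ + 1) * Ψ⁺ G × (Δ + 1) * Ψ⁺ G ≤ Δ * n)
proposition3p2 n G Δ no-isolated (degree≤Δ , _) =
  gameValue-bounds G degree≤Δ no-isolated Minimizer , gameValue-bounds G degree≤Δ no-isolated Maximizer
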